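{- For every graph $G$, $\mathrm{sn}(G)\ge\min(\lambda(G),|V(G)|)$.
   Context: Graphs are finite, multiple edges allowed, no loops; $\lambda(G)$ is the edge-connectivity (minimum number of edges, with multiplicity, whose removal disconnects $G$ or leaves a single vertex). A scramble is a finite collection of nonempty vertex sets (eggs) each inducing a connected subgraph; its order is $\min(h,e)$ where $h$ is the minimum size of a vertex set meeting every egg and $e$ is the minimum of $|E(A,A^C)|$ over all $A\subseteq V$ such that some egg is contained in $A$ and some egg in $A^C$ ($+\infty$ if none). The scramble number $\mathrm{sn}$ is the maximum order of a scramble. -}

module Defs where

open import Data.Nat using (ℕ; zero; suc; _+_; _≤_)
open import Data.Bool using (Bool; true; false; _xor_)
open import Data.Fin using (Fin)
open import Data.Fin.Subset using (Subset; _∈_; _⊆_; ∁; ∣_∣; ⊤)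
open import Data.List using (List; []; _∷_; length)
open import Data.List.Relation.Unary.All using (All)
open import Data.List.Membership.Propositional using () renaming (_∈_ to _∈ˡ_)
open import Data.Vec using (Vec; []; _∷_; lookup)
open import Data.Product using (Σ; _×_; _,_; proj₁; proj₂; ∃)
open import Data.Sum using (_⊎_)
open import Relation.Binary.PropositionalEquality using (_≡_; _≢_)
open import Relation.Nullary using (¬_)

-- Finite multigraph without loops: vertex set Fin n, edges as a list of
-- (unordered) pairs of distinct vertices; repetitions = parallel edges.
record Graph : Set where
  field
    n       : ℕ
    edges   : List (Fin n × Fin n)
    loopless : All (λ e → proj₁ e ≢ proj₂ e) edges
open Graph public

Edge : ℕ → Set
Edge n = Fin n × Fin n

Adj : ∀ {n} → List (Edge n) → Fin n → Fin n → Set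
Adj es u v = ((u , v) ∈ˡ es) ⊎ ((v , u) ∈ˡ es)

data Reach {n : ℕ} (es : List (Edge n)) (P : Subset n) : Fin n → Fin n → Set where
  here : ∀ {u} → Reach es P u u
  step : ∀ {u v w} → Adj es u v → v ∈ P → Reach es P v w → Reach es P u w

Connected : (n : ℕ) → List (Edge n) → Set
Connected n es = ∀ (u v : Fin n) → Reach es ⊤ u v

kept : ∀ {A : Set} (es : List A) → Vec Bool (length es) → List A
kept [] [] = []
kept (e ∷ es) (true ∷ m) = e ∷ kept es m
kept (e ∷ es) (false ∷ m) = kept es m

removed : ∀ {A : Set} (es : List A) → Vec Bool (length es) → ℕ
removed [] [] = 0
removed (e ∷ es) (true ∷ m) = removed es m
removed (e ∷ es) (false ∷ m) = suc (removed es m)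

Breaks : (G : Graph) → Vec Bool (length (edges G)) → Set
Breaks G m = (¬ Connected (n G) (kept (edges G) m)) ⊎ (n G ≤ 1)

IsEdgeConnectivity : Graph → ℕ → Set
IsEdgeConnectivity G l =
  (Σ (Vec Bool (length (edges G))) λ m → (removed (edges G) m ≡ l) × Breaks G m)
  × (∀ m → Breaks G m → l ≤ removed (edges G) m)

IsEgg : (G : Graph) → Subset (n G) → Set
IsEgg G E = (∃ λ v → v ∈ E) × (∀ u v → u ∈ E → v ∈ E → Reach (edges G) E u v)

Scramble : Graph → Set
Scramble G = List (Subset (n G))

IsScramble : (G : Graph) → Scramble G → Set
IsScramble G S = All (IsEgg G) S

cutSize : ∀ {n} → List (Edge n) → Subset n → ℕ
cutSize [] A = 0
cutSize ((u , v) ∷ es) A with lookup A u xor lookup A v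
... | true  = suc (cutSize es A)
... | false = cutSize es A

HittingAtLeast : (G : Graph) → Scramble G → ℕ → Set
HittingAtLeast G S k =
  ∀ (H : Subset (n G)) → All (λ E → ∃ λ v → v ∈ H × v ∈ E) S → k ≤ ∣ H ∣

-- every egg-cut of S has size ≥ k  (i.e. e ≥ k, with e = +∞ if none)
EggCutAtLeast : (G : Graph) → Scramble G → ℕ → Set
EggCutAtLeast G S k =
  ∀ (A : Subset (n G)) →
    (∃ λ E → E ∈ˡ S × E ⊆ A) → (∃ λ E → E ∈ˡ S × E ⊆ ∁ A) →
    k ≤ cutSize (edges G) A

OrderAtLeast : (G : Graph) → Scramble G → ℕ → Set
OrderAtLeast G S k = HittingAtLeast G S k × EggCutAtLeast G S k

SnAtLeast : Graph → ℕ → Set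
SnAtLeast G k = Σ (Scramble G) λ S → IsScramble G S × OrderAtLeast G S k

module Submission where

-- The scramble of all singleton eggs has order at least min(λ(G), |V(G)|): a
-- hitting set must contain every vertex, and an egg-cut A separates two
-- vertices, so deleting the edges of E(A, Aᶜ) disconnects G and hence
-- |E(A, Aᶜ)| ≥ λ(G).

open import Defs
open import Data.Nat using (ℕ; _⊓_; _≤_; suc)
open import Data.Nat.Properties using (m⊓n≤m; m⊓n≤n; ≤-trans; ≤-reflexive)
open import Data.Bool using (Bool; true; false; not; _xor_)
open import Data.Fin using (Fin)
open import Data.Fin.Subset using (Subset; ⁅_⁆; ⊤; ∁; ∣_∣; _⊆_) renaming (_∈_ to _∈ₛ_)
open import Data.Fin.Subset.Properties using (x∈⁅x⁆; x∈⁅y⁆⇒x≡y; ∣⊤∣≡n; p⊆q⇒∣p∣≤∣q∣; x∈∁p⇒x∉p)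
open import Data.List using (List; []; _∷_; length; map; allFin)
open import Data.List.Relation.Unary.All as All using (All)
open import Data.List.Relation.Unary.All.Properties using (map⁺; map⁻)
open import Data.List.Relation.Unary.Any using (here; there)
open import Data.List.Membership.Propositional using () renaming (_∈_ to _∈ˡ_)
open import Data.List.Membership.Propositional.Properties using (∈-allFin; ∈-map⁻)
open import Data.Vec using (Vec; []; _∷_; lookup)
open import Data.Vec.Properties using ([]=⇒lookup; lookup⇒[]=)
open import Data.Product using (_,_)
open import Data.Sum using (inj₁; inj₂)
open import Relation.Binary.PropositionalEquality using (_≡_; refl; sym; trans; subst; cong)
open import Relation.Nullary using (¬_)

not-xor≡true⇒≡ : ∀ a b → not (a xor b) ≡ true → a ≡ b
not-xor≡true⇒≡ false false _ = refl
not-xor≡true⇒≡ true  true  _ = refl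

module _ {n : ℕ} where

  cutMask : (es : List (Edge n)) → Subset n → Vec Bool (length es)
  cutMask [] A = []
  cutMask ((u , v) ∷ es) A = not (lookup A u xor lookup A v) ∷ cutMask es A

  removed-cutMask : (es : List (Edge n)) (A : Subset n) →
                    removed es (cutMask es A) ≡ cutSize es A
  removed-cutMask [] A = refl
  removed-cutMask ((u , v) ∷ es) A with lookup A u xor lookup A v
  ... | true  = cong suc (removed-cutMask es A)
  ... | false = removed-cutMask es A

  kept-cutMask-sameSide : (es : List (Edge n)) (A : Subset n) {u v : Fin n} →
                          (u , v) ∈ˡ kept es (cutMask es A) → lookup A u ≡ lookup A v
  kept-cutMask-sameSide ((a , b) ∷ es) A p with not (lookup A a xor lookup A b) in eq
  kept-cutMask-sameSide ((a , b) ∷ es) A (here refl) | true = not-xor≡true⇒≡ _ _ eq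
  kept-cutMask-sameSide ((a , b) ∷ es) A (there p)   | true = kept-cutMask-sameSide es A p
  ... | false = kept-cutMask-sameSide es A p

  Reach-kept-cutMask-sameSide : (es : List (Edge n)) (A : Subset n) {u w : Fin n} →
                                Reach (kept es (cutMask es A)) ⊤ u w → lookup A u ≡ lookup A w
  Reach-kept-cutMask-sameSide es A here = refl
  Reach-kept-cutMask-sameSide es A (step (inj₁ uv) _ r) =
    trans (kept-cutMask-sameSide es A uv) (Reach-kept-cutMask-sameSide es A r)
  Reach-kept-cutMask-sameSide es A (step (inj₂ vu) _ r) =
    trans (sym (kept-cutMask-sameSide es A vu)) (Reach-kept-cutMask-sameSide es A r)

  cutMask-disconnects : (es : List (Edge n)) (A : Subset n) {u w : Fin n} →
                        u ∈ₛ A → w ∈ₛ ∁ A → ¬ Connected n (kept es (cutMask es A))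
  cutMask-disconnects es A {u} {w} u∈A w∈∁A connected = x∈∁p⇒x∉p w∈∁A w∈A
    where
    w∈A : w ∈ₛ A
    w∈A = lookup⇒[]= w A
            (trans (sym (Reach-kept-cutMask-sameSide es A (connected u w))) ([]=⇒lookup u∈A))

edgeConnectivity≤cutSize : ∀ G l → IsEdgeConnectivity G l → (A : Subset (n G)) {u w : Fin (n G)} →
                           u ∈ₛ A → w ∈ₛ ∁ A → l ≤ cutSize (edges G) A
edgeConnectivity≤cutSize G l (_ , minimal) A u∈A w∈∁A =
  ≤-trans (minimal (cutMask (edges G) A) (inj₁ (cutMask-disconnects (edges G) A u∈A w∈∁A)))
          (≤-reflexive (removed-cutMask (edges G) A))

singletons : (G : Graph) → Scramble G
singletons G = map ⁅_⁆ (allFin (n G))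

singleton-isEgg : (G : Graph) (v : Fin (n G)) → IsEgg G ⁅ v ⁆
singleton-isEgg G v = (v , x∈⁅x⁆ v) , λ a b a∈v b∈v →
  subst (Reach (edges G) ⁅ v ⁆ a) (trans (x∈⁅y⁆⇒x≡y v a∈v) (sym (x∈⁅y⁆⇒x≡y v b∈v))) here

singletons-isScramble : (G : Graph) → IsScramble G (singletons G)
singletons-isScramble G = map⁺ (All.tabulate λ {v} _ → singleton-isEgg G v)

singletons-hittingAtLeast : (G : Graph) → HittingAtLeast G (singletons G) (n G)
singletons-hittingAtLeast G H hits =
  ≤-trans (≤-reflexive (sym (∣⊤∣≡n (n G)))) (p⊆q⇒∣p∣≤∣q∣ ⊤⊆H)
  where
  ⊤⊆H : ⊤ ⊆ H
  ⊤⊆H {v} _ with All.lookup (map⁻ hits) (∈-allFin v)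
  ... | x , x∈H , x∈v = subst (_∈ₛ H) (x∈⁅y⁆⇒x≡y v x∈v) x∈H

singletons-eggCutAtLeast : ∀ G l → IsEdgeConnectivity G l → EggCutAtLeast G (singletons G) l
singletons-eggCutAtLeast G l isλ A (_ , E∈S , E⊆A) (_ , F∈S , F⊆∁A)
  with ∈-map⁻ ⁅_⁆ E∈S | ∈-map⁻ ⁅_⁆ F∈S
... | u , _ , refl | w , _ , refl =
  edgeConnectivity≤cutSize G l isλ A (E⊆A (x∈⁅x⁆ u)) (F⊆∁A (x∈⁅x⁆ w))

lemma2p6 : ∀ (G : Graph) (l : ℕ) → IsEdgeConnectivity G l → SnAtLeast G (l ⊓ n G)
lemma2p6 G l isλ = singletons G , singletons-isScramble G , hitting , eggCut
  where
  hitting : HittingAtLeast G (singletons G) (l ⊓ n G)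
  hitting H hits = ≤-trans (m⊓n≤n l (n G)) (singletons-hittingAtLeast G H hits)

  eggCut : EggCutAtLeast G (singletons G) (l ⊓ n G)
  eggCut A inA inAᶜ = ≤-trans (m⊓n≤m l (n G)) (singletons-eggCutAtLeast G l isλ A inA inAᶜ)
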